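{- Whenever Algorithm 1 (described in the context), run on nonnegative vectors $A,B\in\mathbb{N}^n$, outputs a vector $C$, then $C = A \star B$ (the error probability is $0$).
   Context: Notation: $[n]=\{0,\dots,n-1\}$; $(A\star B)_k=\sum_{i+j=k}A_iB_j$; $\|V\|_1=\sum_i|V_i|$; $(\partial^dV)_i=i^dV_i$, $\partial=\partial^1$; for $h:[n]\to[m]$, $h(V)_j=\sum_{i:\,h(i)=j}V_i$; cyclic convolution $(P\star_mQ)_k=\sum_{i+j\equiv k\pmod m}P_iQ_j$; $\log$ is base 2. Linear hash family: if $m$ is odd, let $N$ be the smallest power of two larger than $n\cdot m$, pick $a$ uniformly at random among the odd numbers in $[N]$, and set $h(x)=(ax\bmod N)\bmod m$; if $m$ is even, sample $h:[n]\to[m-1]$ from this family with parameter $m-1$ and view it as a map $[n]\to[m]$. Algorithm 3 (input nonnegative $A,B$ and $m$): sample a linear hash function $h:[n]\to[m]$; compute (by FFT) $X=h(A)\star_mh(B)$, $Y=h(\partial A)\star_mh(B)+h(A)\star_mh(\partial B)$, $Z=h(\partial^2A)\star_mh(B)+2h(\partial A)\star_mh(\partial B)+h(A)\star_mh(\partial^2B)$; set $R=0$; for each $k\in[m]$, if $X_k\ne0$ and $Y_k^2=X_kZ_k$, let $z=Y_k/X_k$ and set $R_z\gets R_z+X_k$; return $R$. Algorithm 1 (input nonnegative $A,B\in\mathbb{N}^n$): for $m=1,2,4,8,\dots$: run Algorithm 3 with parameter $m$ independently $2\log m$ times, obtaining vectors $R$; let $C$ be the coordinate-wise maximum of these vectors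 $R$ (the zero vector if there are none); if $\|C\|_1=\|A\|_1\cdot\|B\|_1$, return $C$. -}

module Defs where

open import Data.Nat using (ℕ; zero; suc; _+_; _*_; _∸_; _^_; _<_; _≟_; _⊔_)
open import Data.Nat.DivMod using (_%_)
open import Data.Nat.Logarithm using (⌊log₂_⌋)
open import Data.Fin using (Fin; toℕ)
open import Data.Bool using (Bool; true; false; if_then_else_; _∧_; not)
open import Data.Vec using (Vec; foldr; map)
open import Relation.Nullary using (does)
open import Relation.Binary.PropositionalEquality using (_≡_)

∑ : ℕ → (ℕ → ℕ) → ℕ
∑ zero    f = 0
∑ (suc n) f = ∑ n f + f n

∑F : ∀ {n} → (Fin n → ℕ) → ℕ
∑F {zero}  V = 0
∑F {suc n} V = V Fin.zero + ∑F (λ i → V (Fin.suc i))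

‖_‖₁ : ∀ {n} → (Fin n → ℕ) → ℕ
‖ V ‖₁ = ∑F V

_==_ : ℕ → ℕ → Bool
x == y = does (x ≟ y)

-- x mod y, only ever used with y ≠ 0
_mod_ : ℕ → ℕ → ℕ
x mod zero    = x
x mod (suc k) = x % suc k

conv : ∀ {n} → (Fin n → ℕ) → (Fin n → ℕ) → ℕ → ℕ
conv A B k = ∑F (λ i → ∑F (λ j →
  if (toℕ i + toℕ j) == k then A i * B j else 0))

pow2Above : ℕ → ℕ
pow2Above zero    = 1
pow2Above (suc x) = 2 ^ suc ⌊log₂ suc x ⌋

-- the odd modulus actually used by the linear hash family for range m
-- (m itself if m is odd, m - 1 if m is even)
oddRange : ℕ → ℕ
oddRange m = if (m mod 2) == 1 then m else m ∸ 1

hashN : ℕ → ℕ → ℕ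
hashN n m = pow2Above (n * oddRange m)

ValidSeed : ℕ → ℕ → ℕ → Set
ValidSeed n m a = ((a mod 2) ≡ 1) Data.Product.× (a < hashN n m)
  where import Data.Product

linHash : ℕ → ℕ → ℕ → ℕ → ℕ
linHash n m a x = ((a * x) mod hashN n m) mod oddRange m

-- h(∂^d V)_j = Σ_{i : h(i) = j} i^d V_i
hashVec : ∀ {n} → (ℕ → ℕ) → ℕ → (Fin n → ℕ) → ℕ → ℕ
hashVec h d V j = ∑F (λ i → if h (toℕ i) == j then toℕ i ^ d * V i else 0)

cyc : ℕ → (ℕ → ℕ) → (ℕ → ℕ) → ℕ → ℕ
cyc m P Q k = ∑ m (λ i → ∑ m (λ j →
  if ((i + j) mod m) == k then P i * Q j else 0))

-- Algorithm 3 with the hash function given by seed a; output indexed by z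
alg3 : ∀ {n} → (Fin n → ℕ) → (Fin n → ℕ) → ℕ → ℕ → ℕ → ℕ
alg3 {n} A B m a z = ∑ m (λ k →
    if not (X k == 0) ∧ ((Y k * Y k) == (X k * Z k)) ∧ (Y k == (z * X k))
    then X k else 0)
  where
  h : ℕ → ℕ
  h = linHash n m a
  hA hB : ℕ → ℕ → ℕ
  hA d = hashVec h d A
  hB d = hashVec h d B
  X Y Z : ℕ → ℕ
  X k = cyc m (hA 0) (hB 0) k
  Y k = cyc m (hA 1) (hB 0) k + cyc m (hA 0) (hB 1) k
  Z k = cyc m (hA 2) (hB 0) k + 2 * cyc m (hA 1) (hB 1) k + cyc m (hA 0) (hB 2) k

-- the vector C computed in the round m = 2^t of Algorithm 1, from the
-- 2 log m = 2t seeds of the independent runs of Algorithm 3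
alg1Round : ∀ {n} → (Fin n → ℕ) → (Fin n → ℕ) → (t : ℕ) → Vec ℕ (2 * t) → ℕ → ℕ
alg1Round A B t as z = foldr _ _⊔_ 0 (map (λ a → alg3 A B (2 ^ t) a z) as)

normOut : ℕ → (ℕ → ℕ) → ℕ
normOut n C = ∑ (2 * n ∸ 1) C

-- Whatever the hash function, every run of Algorithm 3 underestimates A ⋆ B
-- coordinatewise.  For a bucket k, X_k, Y_k and Z_k are the zeroth, first and
-- second moments of the positions i + j of the pairs (i, j) hashed to k,
-- weighted by A_i B_j.  If Y_k² = X_k Z_k and Y_k = z X_k, the weighted variance
-- Σ A_i B_j (i + j − z)² = Z_k − 2 z Y_k + z² X_k vanishes, so the whole weight
-- X_k of the bucket sits at position z.  Hence the maximum C over the runs is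
-- still at most A ⋆ B, and as ‖A ⋆ B‖₁ = ‖A‖₁ ‖B‖₁, the final test
-- ‖C‖₁ = ‖A‖₁ ‖B‖₁ forces C = A ⋆ B.

module Submission where

open import Defs
open import Data.Nat using (ℕ; _*_; _∸_; _^_; _<_)
open import Data.Fin using (Fin)
open import Data.Vec using (Vec)
open import Data.Vec.Relation.Unary.All using (All)
open import Relation.Binary.PropositionalEquality using (_≡_)

open import Data.Nat using (zero; suc; _+_; _≤_; _⊔_; z≤n; s≤s⁻¹; NonZero; ≢-nonZero; >-nonZero; ∣_-_∣)
open import Data.Nat.Properties
open import Data.Nat.DivMod using (m%n<n)
open import Data.Nat.Tactic.RingSolver using (solve-∀)
open import Data.Fin using (toℕ; fromℕ; fromℕ<)
open import Data.Fin.Properties using (toℕ<n; toℕ-fromℕ; toℕ-fromℕ<; toℕ-inject₁)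
open import Data.Bool using (Bool; true; false; if_then_else_; _∧_; not)
open import Data.Vec using ([]; _∷_; foldr; map)
open import Data.Vec.Functional using (init; last)
open import Data.Product using (_×_; _,_; proj₁; proj₂)
open import Function using (_∘_)
open import Relation.Nullary using (yes; no; Reflects; ofʸ; ofⁿ; proof)
open import Relation.Binary.PropositionalEquality using (refl; sym; trans; cong; cong₂; subst; subst₂; module ≡-Reasoning)
open import Algebra.Properties.CommutativeMonoid.Sum +-0-commutativeMonoid
  using (sum; sum-cong-≗; sum-init-last; sum-replicate-zero; ∑-distrib-+; ∑-comm)
open import Algebra.Properties.Semiring.Sum +-*-semiring
  using (*-distribˡ-sum; *-distribʳ-sum)

sum-mono : ∀ {n} {f g : Fin n → ℕ} → (∀ i → f i ≤ g i) → sum f ≤ sum g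
sum-mono {zero}  f≤g = z≤n
sum-mono {suc n} f≤g = +-mono-≤ (f≤g Fin.zero) (sum-mono (f≤g ∘ Fin.suc))

∑F≡sum : ∀ {n} (f : Fin n → ℕ) → ∑F f ≡ sum f
∑F≡sum {zero}  f = refl
∑F≡sum {suc n} f = cong (f Fin.zero +_) (∑F≡sum (f ∘ Fin.suc))

∑≡sum : ∀ n (f : ℕ → ℕ) → ∑ n f ≡ sum {n} (f ∘ toℕ)
∑≡sum zero    f = refl
∑≡sum (suc n) f = begin
  ∑ n f + f n
    ≡⟨ cong₂ _+_ (∑≡sum n f) (cong f (sym (toℕ-fromℕ n))) ⟩
  sum {n} (f ∘ toℕ) + f (toℕ (fromℕ n))
    ≡⟨ cong (_+ f (toℕ (fromℕ n))) (sum-cong-≗ {n} (cong f ∘ sym ∘ toℕ-inject₁)) ⟩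
  sum {n} (init (f ∘ toℕ)) + last (f ∘ toℕ)
    ≡⟨ sum-init-last {n} (f ∘ toℕ) ⟨
  sum {suc n} (f ∘ toℕ)
    ∎
  where open ≡-Reasoning

sum-collapse : ∀ {m} x (g : ℕ → ℕ) → x < m →
  sum {m} (λ a → if x == toℕ a then g (toℕ a) else 0) ≡ g x
sum-collapse {suc m} zero    g _   = trans (cong (g 0 +_) (sum-replicate-zero m)) (+-identityʳ (g 0))
sum-collapse {suc m} (suc x) g x<m = sum-collapse x (g ∘ suc) (s≤s⁻¹ x<m)

+-≤-≡⇒≡ : ∀ {a b c d} → a ≤ c → b ≤ d → a + b ≡ c + d → a ≡ c × b ≡ d
+-≤-≡⇒≡ {a} {b} {c} {d} a≤c b≤d eq =
  ≤-antisym a≤c (+-cancelʳ-≤ b c a (≤-trans (+-monoʳ-≤ c b≤d) (≤-reflexive (sym eq)))) ,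
  ≤-antisym b≤d (+-cancelˡ-≤ a d b (≤-trans (+-monoˡ-≤ d a≤c) (≤-reflexive (sym eq))))

sum-≤-≡⇒≗ : ∀ {n} {f g : Fin n → ℕ} → (∀ i → f i ≤ g i) → sum f ≡ sum g → ∀ i → f i ≡ g i
sum-≤-≡⇒≗ {suc n} {f} {g} f≤g eq = λ
  { Fin.zero    → proj₁ split
  ; (Fin.suc i) → sum-≤-≡⇒≗ (f≤g ∘ Fin.suc) (proj₂ split) i
  }
  where
  split : f Fin.zero ≡ g Fin.zero × sum (f ∘ Fin.suc) ≡ sum (g ∘ Fin.suc)
  split = +-≤-≡⇒≡ (f≤g Fin.zero) (sum-mono (f≤g ∘ Fin.suc)) eq

record IsPositiveLinear {I : Set} (L : (I → ℕ) → ℕ) : Set where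
  field
    additive    : ∀ f g → L (λ x → f x + g x) ≡ L f + L g
    homogeneous : ∀ c f → L (λ x → c * f x) ≡ c * L f
    monotone    : ∀ {f g} → (∀ x → f x ≤ g x) → L f ≤ L g

  cong-≗ : ∀ {f g} → (∀ x → f x ≡ g x) → L f ≡ L g
  cong-≗ f≗g = ≤-antisym (monotone (≤-reflexive ∘ f≗g)) (monotone (≤-reflexive ∘ sym ∘ f≗g))

sum-isPositiveLinear : ∀ {n} → IsPositiveLinear (sum {n})
sum-isPositiveLinear = record
  { additive    = ∑-distrib-+
  ; homogeneous = λ c f → sym (*-distribˡ-sum c f)
  ; monotone    = sum-mono
  }

iterated-isPositiveLinear : ∀ {I J : Set} {L : (I → ℕ) → ℕ} {M : (J → ℕ) → ℕ} →
  IsPositiveLinear L → IsPositiveLinear M →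
  IsPositiveLinear (λ (f : I × J → ℕ) → L (λ i → M (λ j → f (i , j))))
iterated-isPositiveLinear isL isM = record
  { additive    = λ f g → trans (L.cong-≗ (λ i → M.additive _ _)) (L.additive _ _)
  ; homogeneous = λ c f → trans (L.cong-≗ (λ i → M.homogeneous c _)) (L.homogeneous c _)
  ; monotone    = λ f≤g → L.monotone (λ i → M.monotone (λ j → f≤g (_ , j)))
  }
  where
  module L = IsPositiveLinear isL
  module M = IsPositiveLinear isM

restrict : ∀ {I : Set} → (I → Bool) → ((I → ℕ) → ℕ) → (I → ℕ) → ℕ
restrict c L f = L (λ x → if c x then f x else 0)

restrict-isPositiveLinear : ∀ {I : Set} (c : I → Bool) {L : (I → ℕ) → ℕ} →
  IsPositiveLinear L → IsPositiveLinear (restrict c L)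
restrict-isPositiveLinear c isL = record
  { additive    = λ f g → trans (cong-≗ (λ x → if-+ (c x))) (additive _ _)
  ; homogeneous = λ k f → trans (cong-≗ (λ x → if-*ˡ (c x) {k})) (homogeneous k _)
  ; monotone    = λ f≤g → monotone (λ x → if-mono (c x) (f≤g x))
  }
  where
  open IsPositiveLinear isL
  if-+ : ∀ b {x y} → (if b then x + y else 0) ≡ (if b then x else 0) + (if b then y else 0)
  if-+ true  = refl
  if-+ false = refl
  if-*ˡ : ∀ b {k x} → (if b then k * x else 0) ≡ k * (if b then x else 0)
  if-*ˡ true          = refl
  if-*ˡ false {k = k} = sym (*-zeroʳ k)
  if-mono : ∀ b {x y} → x ≤ y → (if b then x else 0) ≤ (if b then y else 0)
  if-mono true  x≤y = x≤y
  if-mono false _   = z≤n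

-- `x == y` reduces to `x ≡ᵇ y`, so `with x ≟ y` cannot abstract it; case on
-- `x == y` together with this instead.
==-reflects : ∀ x y → Reflects (x ≡ y) (x == y)
==-reflects x y = proof (x ≟ y)

∣m-n∣²+2mn≡m²+n² : ∀ m n → ∣ m - n ∣ * ∣ m - n ∣ + 2 * m * n ≡ m * m + n * n
∣m-n∣²+2mn≡m²+n² zero    n       = +-identityʳ (n * n)
∣m-n∣²+2mn≡m²+n² (suc m) zero    = cong (suc m * suc m +_) (*-zeroʳ (2 * suc m))
∣m-n∣²+2mn≡m²+n² (suc m) (suc n) = begin
  d² + 2 * suc m * suc n            ≡⟨ shift d² m n ⟩
  (d² + 2 * m * n) + 2 * (m + n + 1) ≡⟨ cong (_+ 2 * (m + n + 1)) (∣m-n∣²+2mn≡m²+n² m n) ⟩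
  (m * m + n * n) + 2 * (m + n + 1) ≡⟨ complete m n ⟩
  suc m * suc m + suc n * suc n     ∎
  where
  open ≡-Reasoning
  d² : ℕ
  d² = ∣ m - n ∣ * ∣ m - n ∣
  shift : ∀ d m n → d + 2 * suc m * suc n ≡ (d + 2 * m * n) + 2 * (m + n + 1)
  shift = solve-∀
  complete : ∀ m n → (m * m + n * n) + 2 * (m + n + 1) ≡ suc m * suc m + suc n * suc n
  complete = solve-∀

deviation-expansion : ∀ w s z →
  w * (∣ s - z ∣ * ∣ s - z ∣) + 2 * z * (s * w) ≡ s * s * w + z * z * w
deviation-expansion w s z = begin
  w * d² + 2 * z * (s * w)  ≡⟨ regroup w d² s z ⟩
  (d² + 2 * s * z) * w      ≡⟨ cong (_* w) (∣m-n∣²+2mn≡m²+n² s z) ⟩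
  (s * s + z * z) * w       ≡⟨ *-distribʳ-+ w (s * s) (z * z) ⟩
  s * s * w + z * z * w     ∎
  where
  open ≡-Reasoning
  d² : ℕ
  d² = ∣ s - z ∣ * ∣ s - z ∣
  regroup : ∀ w d s z → w * d + 2 * z * (s * w) ≡ (d + 2 * s * z) * w
  regroup = solve-∀

≤-deviation+indicator : ∀ w s z →
  w ≤ w * (∣ s - z ∣ * ∣ s - z ∣) + (if s == z then w else 0)
≤-deviation+indicator w s z with s == z | ==-reflects s z
... | true  | ofʸ refl = m≤n+m w _
... | false | ofⁿ s≢z  = ≤-trans (m≤m*n w (d * d) {{m*n≢0 d d}}) (m≤m+n _ 0)
  where
  d : ℕ
  d = ∣ s - z ∣
  instance
    d≢0 : NonZero d
    d≢0 = ≢-nonZero (s≢z ∘ ∣m-n∣≡0⇒m≡n)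

module _ {I : Set} {L : (I → ℕ) → ℕ} (isL : IsPositiveLinear L) where
  open IsPositiveLinear isL

  zero-variance⇒concentrated : ∀ (w s : I → ℕ) z →
    L (λ x → s x * w x) * L (λ x → s x * w x) ≡ L w * L (λ x → s x * s x * w x) →
    L (λ x → s x * w x) ≡ z * L w →
    L w ≤ L (λ x → if s x == z then w x else 0)
  zero-variance⇒concentrated w s z Y²≡XZ Y≡zX with L w ≟ 0
  ... | yes X≡0 = ≤-trans (≤-reflexive X≡0) z≤n
  ... | no  X≢0 = begin
    X                         ≤⟨ monotone (λ x → ≤-deviation+indicator (w x) (s x) z) ⟩
    L (λ x → dev x + ind x)   ≡⟨ additive dev ind ⟩
    L dev + L ind             ≡⟨ cong (_+ L ind) L-dev≡0 ⟩
    L ind                     ∎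
    where
    open ≤-Reasoning
    X Y Z : ℕ
    X = L w
    Y = L (λ x → s x * w x)
    Z = L (λ x → s x * s x * w x)
    dev ind : I → ℕ
    dev x = w x * (∣ s x - z ∣ * ∣ s x - z ∣)
    ind x = if s x == z then w x else 0

    Z≡z²X : Z ≡ z * z * X
    Z≡z²X = *-cancelˡ-≡ Z (z * z * X) X {{≢-nonZero X≢0}} (begin-equality
      X * Z             ≡⟨ Y²≡XZ ⟨
      Y * Y             ≡⟨ cong (λ y → y * y) Y≡zX ⟩
      z * X * (z * X)   ≡⟨ regroup z X ⟩
      X * (z * z * X)   ∎)
      where
      regroup : ∀ z X → z * X * (z * X) ≡ X * (z * z * X)
      regroup = solve-∀

    expansion : L dev + 2 * z * Y ≡ Z + z * z * X
    expansion = begin-equality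
      L dev + 2 * z * Y                             ≡⟨ cong (L dev +_) (homogeneous (2 * z) _) ⟨
      L dev + L (λ x → 2 * z * (s x * w x))         ≡⟨ additive dev _ ⟨
      L (λ x → dev x + 2 * z * (s x * w x))         ≡⟨ cong-≗ (λ x → deviation-expansion (w x) (s x) z) ⟩
      L (λ x → s x * s x * w x + z * z * w x)       ≡⟨ additive _ _ ⟩
      Z + L (λ x → z * z * w x)                     ≡⟨ cong (Z +_) (homogeneous (z * z) w) ⟩
      Z + z * z * X                                 ∎

    L-dev≡0 : L dev ≡ 0
    L-dev≡0 = +-cancelʳ-≡ (z * z * X + z * z * X) (L dev) 0 (begin-equality
      L dev + (z * z * X + z * z * X)   ≡⟨ cong (L dev +_) (double z X) ⟨
      L dev + 2 * z * (z * X)           ≡⟨ cong (λ y → L dev + 2 * z * y) Y≡zX ⟨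
      L dev + 2 * z * Y                 ≡⟨ expansion ⟩
      Z + z * z * X                     ≡⟨ cong (_+ z * z * X) Z≡z²X ⟩
      z * z * X + z * z * X             ∎)
      where
      double : ∀ z X → 2 * z * (z * X) ≡ z * z * X + z * z * X
      double = solve-∀

pairSum : ∀ {m n} → (Fin m × Fin n → ℕ) → ℕ
pairSum f = sum (λ i → sum (λ j → f (i , j)))

pairSum-isPositiveLinear : ∀ {m n} → IsPositiveLinear (pairSum {m} {n})
pairSum-isPositiveLinear = iterated-isPositiveLinear sum-isPositiveLinear sum-isPositiveLinear

_⊗_ : ∀ {m n} → (Fin m → ℕ) → (Fin n → ℕ) → Fin m × Fin n → ℕ
(u ⊗ v) (i , j) = u i * v j

pairSum-⊗ : ∀ {m n} (u : Fin m → ℕ) (v : Fin n → ℕ) → pairSum (u ⊗ v) ≡ sum u * sum v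
pairSum-⊗ u v = begin
  sum (λ i → sum (λ j → u i * v j))  ≡⟨ sum-cong-≗ (λ i → *-distribˡ-sum (u i) v) ⟨
  sum (λ i → u i * sum v)            ≡⟨ *-distribʳ-sum (sum v) u ⟨
  sum u * sum v                      ∎
  where open ≡-Reasoning

sum-pairSum-partition : ∀ {m n N} (key : Fin m × Fin n → ℕ) → (∀ p → key p < N) →
  ∀ f → sum {N} (λ k → pairSum (λ p → if key p == toℕ k then f p else 0)) ≡ pairSum f
sum-pairSum-partition {m} {n} {N} key key<N f = begin
  sum (λ k → sum (λ i → sum (λ j → g k i j)))  ≡⟨ ∑-comm (λ k i → sum (λ j → g k i j)) ⟩
  sum (λ i → sum (λ k → sum (λ j → g k i j)))  ≡⟨ sum-cong-≗ (λ i → ∑-comm (λ k j → g k i j)) ⟩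
  sum (λ i → sum (λ j → sum (λ k → g k i j)))  ≡⟨ sum-cong-≗ (λ i → sum-cong-≗ (λ j →
                                                    sum-collapse (key (i , j)) _ (key<N (i , j)))) ⟩
  pairSum f                                    ∎
  where
  open ≡-Reasoning
  g : Fin N → Fin m → Fin n → ℕ
  g k i j = if key (i , j) == toℕ k then f (i , j) else 0

mod-< : ∀ x m .{{_ : NonZero m}} → x mod m < m
mod-< x (suc m) = m%n<n x (suc m)

module Hashing (m : ℕ) (h : ℕ → ℕ) (h<m : ∀ x → h x < m) {n : ℕ} where

  instance
    m≢0 : NonZero m
    m≢0 = >-nonZero (≤-<-trans z≤n (h<m 0))

  bucket : Fin n × Fin n → ℕ
  bucket (i , j) = (h (toℕ i) + h (toℕ j)) mod m

  bucketSum : ℕ → (Fin n × Fin n → ℕ) → ℕ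
  bucketSum k = restrict (λ p → bucket p == k) pairSum

  bucketSum-isPositiveLinear : ∀ k → IsPositiveLinear (bucketSum k)
  bucketSum-isPositiveLinear k = restrict-isPositiveLinear _ pairSum-isPositiveLinear

  sum-bucketSum : ∀ f → sum {m} (λ k → bucketSum (toℕ k) f) ≡ pairSum f
  sum-bucketSum = sum-pairSum-partition bucket (λ p → mod-< _ m)

  sum-hashVec : ∀ d (V : Fin n → ℕ) (F : ℕ → ℕ) →
    sum {m} (λ a → hashVec h d V (toℕ a) * F (toℕ a)) ≡ sum (λ i → toℕ i ^ d * V i * F (h (toℕ i)))
  sum-hashVec d V F = begin
    sum (λ a → ∑F (λ i → hit a i (u i)) * F (toℕ a))
      ≡⟨ sum-cong-≗ {m} (λ a → cong (_* F (toℕ a)) (∑F≡sum {n} _)) ⟩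
    sum (λ a → sum (λ i → hit a i (u i)) * F (toℕ a))
      ≡⟨ sum-cong-≗ {m} (λ a → *-distribʳ-sum {n} (F (toℕ a)) _) ⟩
    sum (λ a → sum (λ i → hit a i (u i) * F (toℕ a)))
      ≡⟨ sum-cong-≗ {m} (λ a → sum-cong-≗ {n} (λ i → if-*ʳ (h (toℕ i) == toℕ a))) ⟩
    sum (λ a → sum (λ i → hit a i (u i * F (toℕ a))))
      ≡⟨ ∑-comm (λ a i → hit a i (u i * F (toℕ a))) ⟩
    sum (λ i → sum (λ a → hit a i (u i * F (toℕ a))))
      ≡⟨ sum-cong-≗ {n} (λ i → sum-collapse (h (toℕ i)) (λ a → u i * F a) (h<m _)) ⟩
    sum (λ i → u i * F (h (toℕ i)))
      ∎
    where
    open ≡-Reasoning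
    u : Fin n → ℕ
    u i = toℕ i ^ d * V i
    hit : Fin m → Fin n → ℕ → ℕ
    hit a i x = if h (toℕ i) == toℕ a then x else 0
    if-*ʳ : ∀ b {x y} → (if b then x else 0) * y ≡ (if b then x * y else 0)
    if-*ʳ true  = refl
    if-*ʳ false = refl

  -- Writing the test for bucket k as a factor δ ∈ {0, 1} lets sum-hashVec
  -- move both hashed vectors back to coordinates.
  cyc-hashVec : ∀ d e (U V : Fin n → ℕ) k →
    cyc m (hashVec h d U) (hashVec h e V) k ≡ bucketSum k (λ (i , j) → (toℕ i ^ d * U i) * (toℕ j ^ e * V j))
  cyc-hashVec d e U V k = begin
    cyc m P Q k
      ≡⟨ ∑≡sum m _ ⟩
    sum {m} (λ a → ∑ m (λ b → if c (toℕ a) b then P (toℕ a) * Q b else 0))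
      ≡⟨ sum-cong-≗ {m} (λ a → ∑≡sum m _) ⟩
    sum {m} (λ a → sum {m} (λ b → if c (toℕ a) (toℕ b) then P (toℕ a) * Q (toℕ b) else 0))
      ≡⟨ sum-cong-≗ {m} (λ a → sum-cong-≗ {m} (λ b → as-δ (c (toℕ a) (toℕ b)) (P (toℕ a)) (Q (toℕ b)))) ⟩
    sum {m} (λ a → sum {m} (λ b → P (toℕ a) * (Q (toℕ b) * δ (toℕ a) (toℕ b))))
      ≡⟨ sum-cong-≗ {m} (λ a → *-distribˡ-sum {m} (P (toℕ a)) _) ⟨
    sum {m} (λ a → P (toℕ a) * sum {m} (λ b → Q (toℕ b) * δ (toℕ a) (toℕ b)))
      ≡⟨ sum-cong-≗ {m} (λ a → cong (P (toℕ a) *_) (sum-hashVec e V (δ (toℕ a)))) ⟩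
    sum {m} (λ a → P (toℕ a) * sum {n} (λ j → v j * δ (toℕ a) (h (toℕ j))))
      ≡⟨ sum-hashVec d U (λ x → sum {n} (λ j → v j * δ x (h (toℕ j)))) ⟩
    sum {n} (λ i → u i * sum {n} (λ j → v j * δ (h (toℕ i)) (h (toℕ j))))
      ≡⟨ sum-cong-≗ {n} (λ i → *-distribˡ-sum {n} (u i) _) ⟩
    sum {n} (λ i → sum {n} (λ j → u i * (v j * δ (h (toℕ i)) (h (toℕ j)))))
      ≡⟨ sum-cong-≗ {n} (λ i → sum-cong-≗ {n} (λ j → as-δ (bucket (i , j) == k) (u i) (v j))) ⟨
    bucketSum k (λ (i , j) → u i * v j)
      ∎
    where
    open ≡-Reasoning
    P Q : ℕ → ℕ
    P = hashVec h d U
    Q = hashVec h e V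
    u v : Fin n → ℕ
    u i = toℕ i ^ d * U i
    v j = toℕ j ^ e * V j
    c : ℕ → ℕ → Bool
    c a b = ((a + b) mod m) == k
    δ : ℕ → ℕ → ℕ
    δ a b = if c a b then 1 else 0
    as-δ : ∀ b x y → (if b then x * y else 0) ≡ x * (y * (if b then 1 else 0))
    as-δ true  x y = cong (x *_) (sym (*-identityʳ y))
    as-δ false x y = sym (trans (cong (x *_) (*-zeroʳ y)) (*-zeroʳ x))

position : ∀ {n} → Fin n × Fin n → ℕ
position (i , j) = toℕ i + toℕ j

antidiagonal : ∀ {n} → (Fin n → ℕ) → (Fin n → ℕ) → ℕ → Fin n × Fin n → ℕ
antidiagonal A B z p = if position p == z then (A ⊗ B) p else 0

conv≡pairSum : ∀ {n} (A B : Fin n → ℕ) z → conv A B z ≡ pairSum (antidiagonal A B z)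
conv≡pairSum {n} A B z = trans (∑F≡sum {n} _) (sum-cong-≗ {n} (λ i → ∑F≡sum {n} _))

module Algorithm3 (m : ℕ) (h : ℕ → ℕ) (h<m : ∀ x → h x < m) {n : ℕ} (A B : Fin n → ℕ) where
  open Hashing m h h<m {n}
  open IsPositiveLinear

  -- These repeat the local definitions of alg3, so that alg3 is output by definition.
  X Y Z : ℕ → ℕ
  X k = cyc m (hashVec h 0 A) (hashVec h 0 B) k
  Y k = cyc m (hashVec h 1 A) (hashVec h 0 B) k + cyc m (hashVec h 0 A) (hashVec h 1 B) k
  Z k = cyc m (hashVec h 2 A) (hashVec h 0 B) k + 2 * cyc m (hashVec h 1 A) (hashVec h 1 B) k
      + cyc m (hashVec h 0 A) (hashVec h 2 B) k

  output : ℕ → ℕ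
  output z = ∑ m (λ k →
    if not (X k == 0) ∧ ((Y k * Y k) == (X k * Z k)) ∧ (Y k == (z * X k)) then X k else 0)

  X≡ : ∀ k → X k ≡ bucketSum k (A ⊗ B)
  X≡ k = trans (cyc-hashVec 0 0 A B k)
               (cong-≗ (bucketSum-isPositiveLinear k) (λ (i , j) → moment₀ (A i) (B j)))
    where
    moment₀ : ∀ a b → 1 * a * (1 * b) ≡ a * b
    moment₀ = solve-∀

  Y≡ : ∀ k → Y k ≡ bucketSum k (λ p → position p * (A ⊗ B) p)
  Y≡ k = begin
    Y k                                        ≡⟨ cong₂ _+_ (cyc-hashVec 1 0 A B k) (cyc-hashVec 0 1 A B k) ⟩
    bucketSum k f₁₀ + bucketSum k f₀₁          ≡⟨ additive isB f₁₀ f₀₁ ⟨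
    bucketSum k (λ p → f₁₀ p + f₀₁ p)          ≡⟨ cong-≗ isB (λ (i , j) → moment₁ (toℕ i) (toℕ j) (A i) (B j)) ⟩
    bucketSum k (λ p → position p * (A ⊗ B) p) ∎
    where
    open ≡-Reasoning
    isB : IsPositiveLinear (bucketSum k)
    isB = bucketSum-isPositiveLinear k
    f₁₀ f₀₁ : Fin n × Fin n → ℕ
    f₁₀ (i , j) = toℕ i ^ 1 * A i * (toℕ j ^ 0 * B j)
    f₀₁ (i , j) = toℕ i ^ 0 * A i * (toℕ j ^ 1 * B j)
    moment₁ : ∀ x y a b → x ^ 1 * a * (y ^ 0 * b) + x ^ 0 * a * (y ^ 1 * b) ≡ (x + y) * (a * b)
    moment₁ = expanded
      where
      expanded : ∀ x y a b → x * 1 * a * (1 * b) + 1 * a * (y * 1 * b) ≡ (x + y) * (a * b)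
      expanded = solve-∀

  Z≡ : ∀ k → Z k ≡ bucketSum k (λ p → position p * position p * (A ⊗ B) p)
  Z≡ k = begin
    Z k
      ≡⟨ cong₂ _+_ (cong₂ _+_ (cyc-hashVec 2 0 A B k) (cong (2 *_) (cyc-hashVec 1 1 A B k)))
                   (cyc-hashVec 0 2 A B k) ⟩
    bucketSum k f₂₀ + 2 * bucketSum k f₁₁ + bucketSum k f₀₂
      ≡⟨ cong (λ t → bucketSum k f₂₀ + t + bucketSum k f₀₂) (homogeneous isB 2 f₁₁) ⟨
    bucketSum k f₂₀ + bucketSum k (λ p → 2 * f₁₁ p) + bucketSum k f₀₂
      ≡⟨ cong (_+ bucketSum k f₀₂) (additive isB f₂₀ _) ⟨
    bucketSum k (λ p → f₂₀ p + 2 * f₁₁ p) + bucketSum k f₀₂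
      ≡⟨ additive isB _ f₀₂ ⟨
    bucketSum k (λ p → f₂₀ p + 2 * f₁₁ p + f₀₂ p)
      ≡⟨ cong-≗ isB (λ (i , j) → moment₂ (toℕ i) (toℕ j) (A i) (B j)) ⟩
    bucketSum k (λ p → position p * position p * (A ⊗ B) p)
      ∎
    where
    open ≡-Reasoning
    isB : IsPositiveLinear (bucketSum k)
    isB = bucketSum-isPositiveLinear k
    f₂₀ f₁₁ f₀₂ : Fin n × Fin n → ℕ
    f₂₀ (i , j) = toℕ i ^ 2 * A i * (toℕ j ^ 0 * B j)
    f₁₁ (i , j) = toℕ i ^ 1 * A i * (toℕ j ^ 1 * B j)
    f₀₂ (i , j) = toℕ i ^ 0 * A i * (toℕ j ^ 2 * B j)
    moment₂ : ∀ x y a b → x ^ 2 * a * (y ^ 0 * b) + 2 * (x ^ 1 * a * (y ^ 1 * b)) + x ^ 0 * a * (y ^ 2 * b)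
                        ≡ (x + y) * (x + y) * (a * b)
    moment₂ = expanded
      where
      expanded : ∀ x y a b → x * (x * 1) * a * (1 * b) + 2 * (x * 1 * a * (y * 1 * b)) + 1 * a * (y * (y * 1) * b)
                           ≡ (x + y) * (x + y) * (a * b)
      expanded = solve-∀

  accepted≤concentrated : ∀ z k →
    (if not (X k == 0) ∧ ((Y k * Y k) == (X k * Z k)) ∧ (Y k == (z * X k)) then X k else 0)
    ≤ bucketSum k (antidiagonal A B z)
  accepted≤concentrated z k
    with not (X k == 0) | (Y k * Y k) == (X k * Z k) | ==-reflects (Y k * Y k) (X k * Z k)
       | Y k == (z * X k) | ==-reflects (Y k) (z * X k)
  ... | false | _    | _          | _    | _        = z≤n
  ... | true  | false | _         | _    | _        = z≤n
  ... | true  | true | _          | false | _       = z≤n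
  ... | true  | true | ofʸ Y²≡XZ  | true | ofʸ Y≡zX =
    ≤-trans (≤-reflexive (X≡ k)) (zero-variance⇒concentrated (bucketSum-isPositiveLinear k) (A ⊗ B) position z
      (subst₂ (λ y x·z → y * y ≡ x·z) (Y≡ k) (cong₂ _*_ (X≡ k) (Z≡ k)) Y²≡XZ)
      (subst₂ (λ y x → y ≡ z * x) (Y≡ k) (X≡ k) Y≡zX))

  output≤conv : ∀ z → output z ≤ conv A B z
  output≤conv z = begin
    output z                                              ≡⟨ ∑≡sum m _ ⟩
    sum {m} (λ k → accepted (toℕ k))                      ≤⟨ sum-mono {m} (accepted≤concentrated z ∘ toℕ) ⟩
    sum {m} (λ k → bucketSum (toℕ k) (antidiagonal A B z)) ≡⟨ sum-bucketSum (antidiagonal A B z) ⟩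
    pairSum (antidiagonal A B z)                          ≡⟨ conv≡pairSum A B z ⟨
    conv A B z                                            ∎
    where
    open ≤-Reasoning
    accepted : ℕ → ℕ
    accepted k = if not (X k == 0) ∧ ((Y k * Y k) == (X k * Z k)) ∧ (Y k == (z * X k)) then X k else 0

oddRange-nonZero∧≤ : ∀ m .{{_ : NonZero m}} → NonZero (oddRange m) × oddRange m ≤ m
oddRange-nonZero∧≤ 1             = _ , ≤-refl
oddRange-nonZero∧≤ (suc (suc k)) with (suc (suc k) mod 2) == 1
... | true  = _ , ≤-refl
... | false = _ , n≤1+n (suc k)

linHash<m : ∀ n m .{{_ : NonZero m}} a x → linHash n m a x < m
linHash<m n m a x = <-≤-trans (mod-< _ (oddRange m) {{odd≢0}}) odd≤m
  where
  odd≢0 : NonZero (oddRange m)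
  odd≢0 = proj₁ (oddRange-nonZero∧≤ m)
  odd≤m : oddRange m ≤ m
  odd≤m = proj₂ (oddRange-nonZero∧≤ m)

alg3≤conv : ∀ {n} (A B : Fin n → ℕ) m .{{_ : NonZero m}} a z → alg3 A B m a z ≤ conv A B z
alg3≤conv {n} A B m a = Algorithm3.output≤conv m (linHash n m a) (linHash<m n m a) A B

foldr-⊔-map-≤ : ∀ {k} (f : ℕ → ℕ) (xs : Vec ℕ k) {c} → (∀ x → f x ≤ c) → foldr _ _⊔_ 0 (map f xs) ≤ c
foldr-⊔-map-≤ f []       f≤c = z≤n
foldr-⊔-map-≤ f (x ∷ xs) f≤c = ⊔-lub (f≤c x) (foldr-⊔-map-≤ f xs f≤c)

alg1Round≤conv : ∀ {n} (A B : Fin n → ℕ) t (as : Vec ℕ (2 * t)) z → alg1Round A B t as z ≤ conv A B z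
alg1Round≤conv A B t as z = foldr-⊔-map-≤ _ as (λ a → alg3≤conv A B (2 ^ t) {{m^n≢0 2 t}} a z)

position<2n∸1 : ∀ {n} (p : Fin n × Fin n) → position p < 2 * n ∸ 1
position<2n∸1 {suc n} (i , j) = begin-strict
  toℕ i + toℕ j   ≤⟨ +-mono-≤ (s≤s⁻¹ (toℕ<n i)) (s≤s⁻¹ (toℕ<n j)) ⟩
  n + n           <⟨ n<1+n (n + n) ⟩
  suc (n + n)     ≡⟨ 2[1+n]∸1 n ⟨
  2 * suc n ∸ 1   ∎
  where
  open ≤-Reasoning
  2[1+n]∸1 : ∀ n → 2 * suc n ∸ 1 ≡ suc (n + n)
  2[1+n]∸1 n = trans (cong (n +_) (+-identityʳ (suc n))) (+-suc n n)

∑-conv : ∀ {n} (A B : Fin n → ℕ) → ∑ (2 * n ∸ 1) (conv A B) ≡ ‖ A ‖₁ * ‖ B ‖₁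
∑-conv {n} A B = begin
  ∑ N (conv A B)                                      ≡⟨ ∑≡sum N _ ⟩
  sum {N} (λ z → conv A B (toℕ z))                    ≡⟨ sum-cong-≗ {N} (conv≡pairSum A B ∘ toℕ) ⟩
  sum {N} (λ z → pairSum (antidiagonal A B (toℕ z)))  ≡⟨ sum-pairSum-partition position position<2n∸1 (A ⊗ B) ⟩
  pairSum (A ⊗ B)                                     ≡⟨ pairSum-⊗ A B ⟩
  sum A * sum B                                       ≡⟨ cong₂ _*_ (∑F≡sum A) (∑F≡sum B) ⟨
  ‖ A ‖₁ * ‖ B ‖₁                                     ∎
  where
  open ≡-Reasoning
  N : ℕ
  N = 2 * n ∸ 1

∑-≤-≡⇒≡ : ∀ N {f g : ℕ → ℕ} → (∀ z → f z ≤ g z) → ∑ N f ≡ ∑ N g → ∀ z → z < N → f z ≡ g z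
∑-≤-≡⇒≡ N {f} {g} f≤g eq z z<N =
  subst (λ x → f x ≡ g x) (toℕ-fromℕ< z<N)
    (sum-≤-≡⇒≗ {N} (f≤g ∘ toℕ) (trans (sym (∑≡sum N f)) (trans eq (∑≡sum N g))) (fromℕ< z<N))

lemma4p5 : (n : ℕ) (A B : Fin n → ℕ) (t : ℕ) (as : Vec ℕ (2 * t))
    → All (ValidSeed n (2 ^ t)) as
    → normOut n (alg1Round A B t as) ≡ ‖ A ‖₁ * ‖ B ‖₁
    → (z : ℕ) → z < 2 * n ∸ 1 → alg1Round A B t as z ≡ conv A B z
lemma4p5 n A B t as _ ‖C‖₁≡‖A‖₁‖B‖₁ =
  ∑-≤-≡⇒≡ (2 * n ∸ 1) (alg1Round≤conv A B t as) (trans ‖C‖₁≡‖A‖₁‖B‖₁ (sym (∑-conv A B)))
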